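{- Let $G$ be a finite simple graph and $C = v_0v_1\cdots v_{m-1}v_0$ a hole of $G$ (indices modulo $m$). Suppose there is a vertex $v$ adjacent to two consecutive vertices $v_i$ and $v_{i+1}$ of $C$ such that $v \notin X_C$ and $v$ lies on no hole of $G$. Then every $C$-avoiding path $P$ from $v$ to a vertex in $V(C)\setminus\{v_i,v_{i+1}\}$ has length at least $2$.
   Context: A hole of a graph is an induced subgraph that is a cycle of length at least $4$. For a hole $C$ of $G$, $X_C$ denotes the set of vertices of $G$ adjacent to all vertices of $C$ (so $X_C \cap V(C)=\emptyset$). A walk (resp. path) $W$ is $C$-avoiding if either $W$ has at least $2$ edges and none of its internal vertices lies in $V(C)\cup X_C$, or $W$ has exactly one edge and at least one of its two vertices is not in $V(C)\cup X_C$. -}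

module Defs where

open import Data.Nat using (ℕ; zero; suc; _≤_; _<_)
open import Data.Fin using (Fin; toℕ; fromℕ; inject₁)
open import Data.Product using (Σ; ∃; _×_)
open import Data.Sum using (_⊎_)
open import Relation.Nullary using (¬_; Dec)
open import Relation.Binary.PropositionalEquality using (_≡_)
open import Function.Definitions using (Injective)

record Graph (n : ℕ) : Set₁ where
  field
    Adj        : Fin n → Fin n → Set
    adj-sym    : ∀ {x y} → Adj x y → Adj y x
    adj-irrefl : ∀ {x} → ¬ Adj x x
    adj-dec    : ∀ x y → Dec (Adj x y)
open Graph public

CycSucc : (m : ℕ) → Fin m → Fin m → Set
CycSucc m i j = (toℕ j ≡ suc (toℕ i)) ⊎ ((suc (toℕ i) ≡ m) × (toℕ j ≡ 0))

CycAdj : (m : ℕ) → Fin m → Fin m → Set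
CycAdj m i j = CycSucc m i j ⊎ CycSucc m j i

IsHole : ∀ {n} → Graph n → (m : ℕ) → (Fin m → Fin n) → Set
IsHole G m c =
  (4 ≤ m) × Injective _≡_ _≡_ c ×
  (∀ i j → (Adj G (c i) (c j) → CycAdj m i j) × (CycAdj m i j → Adj G (c i) (c j)))

OnHole : ∀ {n} → Graph n → Fin n → Set
OnHole {n} G v = Σ ℕ λ m → Σ (Fin m → Fin n) λ c → IsHole G m c × ∃ λ l → c l ≡ v

InC : ∀ {n m} → (Fin m → Fin n) → Fin n → Set
InC c x = ∃ λ l → c l ≡ x

InX : ∀ {n m} → Graph n → (Fin m → Fin n) → Fin n → Set
InX G c x = ∀ l → Adj G x (c l)

InCX : ∀ {n m} → Graph n → (Fin m → Fin n) → Fin n → Set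
InCX G c x = InC c x ⊎ InX G c x

-- A path with k edges: vertices p 0, ..., p k, pairwise distinct,
-- consecutive ones adjacent.
IsPath : ∀ {n} → Graph n → (k : ℕ) → (Fin (suc k) → Fin n) → Set
IsPath G k p = Injective _≡_ _≡_ p × (∀ (t : Fin k) → Adj G (p (inject₁ t)) (p (Data.Fin.suc t)))

CAvoiding : ∀ {n m} → Graph n → (Fin m → Fin n) → (k : ℕ) → (Fin (suc k) → Fin n) → Set
CAvoiding G c k p =
  ((2 ≤ k) × (∀ (t : Fin (suc k)) → 0 < toℕ t → toℕ t < k → ¬ InCX G c (p t)))
  ⊎ ((k ≡ 1) × (¬ InCX G c (p Data.Fin.zero) ⊎ ¬ InCX G c (p (fromℕ k))))

-- A one-edge C-avoiding path from v would put v off C and make v adjacent to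
-- a vertex c l of C other than the consecutive neighbours c i, c i′.  Cut the
-- cycle at the edge c i c i′ into the induced path c i′ = d 0, …, d M = c i;
-- v sees both ends and the interior vertex c l = d q, and misses some d s
-- since v ∉ X_C.  The maximal run of non-neighbours of v around s is bounded
-- by two neighbours d a, d b of v that lie inside [0, q] or inside [q, M],
-- so d a and d b are not adjacent, and v d a … d b v is a hole through v.
module Submission where

open import Defs
open import Data.Nat
open import Data.Nat.Properties
open import Data.Nat.DivMod using (_mod_; m<n⇒m%n≡m)
open import Data.Fin using (Fin; zero; toℕ; fromℕ)
open import Data.Fin.Properties using (toℕ<n; toℕ-injective; toℕ-fromℕ<; ¬∀⟶∃¬)
open import Data.Product using (∃; _×_; _,_; proj₁; proj₂)
open import Data.Sum using (_⊎_; inj₁; inj₂; [_,_]′)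
open import Data.Empty using (⊥-elim)
open import Function using (_∘_)
open import Relation.Nullary using (¬_; Dec; yes; no)
open import Relation.Binary.Definitions using (tri<; tri≈; tri>)
open import Relation.Binary.PropositionalEquality

private
  variable
    n m M a b j s t t′ : ℕ

-- CycSucc m i j unfolds to CycSuccℕ m (toℕ i) (toℕ j).
CycSuccℕ : ℕ → ℕ → ℕ → Set
CycSuccℕ m t t′ = (t′ ≡ suc t) ⊎ ((suc t ≡ m) × (t′ ≡ 0))

CycAdjℕ : ℕ → ℕ → ℕ → Set
CycAdjℕ m t t′ = CycSuccℕ m t t′ ⊎ CycSuccℕ m t′ t

cycAdj-sym : CycAdjℕ m t t′ → CycAdjℕ m t′ t
cycAdj-sym (inj₁ r) = inj₂ r
cycAdj-sym (inj₂ r) = inj₁ r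

record IsHoleℕ (G : Graph n) (m : ℕ) (d : ℕ → Fin n) : Set where
  field
    length≥4   : 4 ≤ m
    injective  : t < m → t′ < m → d t ≡ d t′ → t ≡ t′
    adj⇒cycAdj : t < m → t′ < m → Adj G (d t) (d t′) → CycAdjℕ m t t′
    cycAdj⇒adj : t < m → t′ < m → CycAdjℕ m t t′ → Adj G (d t) (d t′)
open IsHoleℕ

toℕ-mod : .{{_ : NonZero m}} → t < m → toℕ (t mod m) ≡ t
toℕ-mod t<m = trans (toℕ-fromℕ< _) (m<n⇒m%n≡m t<m)

isHoleℕ : {G : Graph n} {c : Fin (suc M) → Fin n} →
          IsHole G (suc M) c → IsHoleℕ G (suc M) (λ t → c (t mod suc M))
isHoleℕ {c = c} (length≥4 , c-inj , c-adj) = record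
  { length≥4   = length≥4
  ; injective  = λ p p′ e → trans (sym (toℕ-mod p)) (trans (cong toℕ (c-inj e)) (toℕ-mod p′))
  ; adj⇒cycAdj = λ p p′ a → subst₂ (CycAdjℕ _) (toℕ-mod p) (toℕ-mod p′) (proj₁ (c-adj _ _) a)
  ; cycAdj⇒adj = λ p p′ r → proj₂ (c-adj _ _) (subst₂ (CycAdjℕ _) (sym (toℕ-mod p)) (sym (toℕ-mod p′)) r)
  }

cycSucc : ℕ → ℕ → ℕ
cycSucc m t with suc t <? m
... | yes _ = suc t
... | no  _ = 0

cycSucc-inner : suc t < m → cycSucc m t ≡ suc t
cycSucc-inner {t} {m} st<m with suc t <? m
... | yes _     = refl
... | no  st≮m = ⊥-elim (st≮m st<m)

cycSucc-last : suc t ≡ m → cycSucc m t ≡ 0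
cycSucc-last {t} {m} st≡m with suc t <? m
... | yes st<m = ⊥-elim (<-irrefl st≡m st<m)
... | no  _    = refl

cycSucc-< : t < m → cycSucc m t < m
cycSucc-< t<m with m≤n⇒m<n∨m≡n t<m
... | inj₁ st<m rewrite cycSucc-inner st<m = st<m
... | inj₂ st≡m rewrite cycSucc-last st≡m  = ≤-<-trans z≤n t<m

cycSucc-injective : t < m → t′ < m → cycSucc m t ≡ cycSucc m t′ → t ≡ t′
cycSucc-injective t<m t′<m e with m≤n⇒m<n∨m≡n t<m | m≤n⇒m<n∨m≡n t′<m
... | inj₁ p | inj₁ p′ rewrite cycSucc-inner p | cycSucc-inner p′ = suc-injective e
... | inj₁ p | inj₂ p′ rewrite cycSucc-inner p | cycSucc-last p′ with () ← e
... | inj₂ p | inj₁ p′ rewrite cycSucc-last p | cycSucc-inner p′ with () ← e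
... | inj₂ p | inj₂ p′ = suc-injective (trans p (sym p′))

cycSucc-surjective : t < m → ∃ λ u → u < m × cycSucc m u ≡ t
cycSucc-surjective {zero}  {suc m} _   = m , ≤-refl , cycSucc-last refl
cycSucc-surjective {suc t}         t<m = t , <⇒≤ t<m , cycSucc-inner t<m

cycSucc⇒CycSucc : t < m → CycSuccℕ m t (cycSucc m t)
cycSucc⇒CycSucc t<m with m≤n⇒m<n∨m≡n t<m
... | inj₁ st<m = inj₁ (cycSucc-inner st<m)
... | inj₂ st≡m = inj₂ (st≡m , cycSucc-last st≡m)

CycSucc⇒cycSucc : t′ < m → CycSuccℕ m t t′ → t′ ≡ cycSucc m t
CycSucc⇒cycSucc t′<m (inj₁ refl)       = sym (cycSucc-inner t′<m)
CycSucc⇒cycSucc t′<m (inj₂ (st≡m , refl)) = sym (cycSucc-last st≡m)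

cycSucc-preserves-CycSucc : t < m → t′ < m →
  CycSuccℕ m t t′ → CycSuccℕ m (cycSucc m t) (cycSucc m t′)
cycSucc-preserves-CycSucc {m = m} t<m t′<m r =
  subst (CycSuccℕ m (cycSucc m _) ∘ cycSucc m) (sym (CycSucc⇒cycSucc t′<m r))
        (cycSucc⇒CycSucc (cycSucc-< t<m))

cycSucc-reflects-CycSucc : t < m → t′ < m →
  CycSuccℕ m (cycSucc m t) (cycSucc m t′) → CycSuccℕ m t t′
cycSucc-reflects-CycSucc {m = m} t<m t′<m r =
  subst (CycSuccℕ m _) (sym (cycSucc-injective t′<m (cycSucc-< t<m) (CycSucc⇒cycSucc (cycSucc-< t′<m) r)))
        (cycSucc⇒CycSucc t<m)

rotate-hole : {G : Graph n} {d : ℕ → Fin n} → IsHoleℕ G m d → IsHoleℕ G m (d ∘ cycSucc m)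
rotate-hole H = record
  { length≥4   = length≥4 H
  ; injective  = λ p p′ e → cycSucc-injective p p′ (injective H (cycSucc-< p) (cycSucc-< p′) e)
  ; adj⇒cycAdj = λ p p′ a → reflect p p′ (adj⇒cycAdj H (cycSucc-< p) (cycSucc-< p′) a)
  ; cycAdj⇒adj = λ p p′ r → cycAdj⇒adj H (cycSucc-< p) (cycSucc-< p′) (preserve p p′ r)
  }
  where
  reflect : t < m → t′ < m → CycAdjℕ m (cycSucc m t) (cycSucc m t′) → CycAdjℕ m t t′
  reflect p p′ (inj₁ r) = inj₁ (cycSucc-reflects-CycSucc p p′ r)
  reflect p p′ (inj₂ r) = inj₂ (cycSucc-reflects-CycSucc p′ p r)
  preserve : t < m → t′ < m → CycAdjℕ m t t′ → CycAdjℕ m (cycSucc m t) (cycSucc m t′)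
  preserve p p′ (inj₁ r) = inj₁ (cycSucc-preserves-CycSucc p p′ r)
  preserve p p′ (inj₂ r) = inj₂ (cycSucc-preserves-CycSucc p′ p r)

shift : ℕ → ℕ → ℕ → ℕ
shift m zero    t = t
shift m (suc j) t = shift m j (cycSucc m t)

shift-hole : {G : Graph n} {d : ℕ → Fin n} → ∀ j → IsHoleℕ G m d → IsHoleℕ G m (d ∘ shift m j)
shift-hole zero    H = H
shift-hole (suc j) H = rotate-hole (shift-hole j H)

shift-< : ∀ j → t < m → shift m j t < m
shift-< zero    t<m = t<m
shift-< (suc j) t<m = shift-< j (cycSucc-< t<m)

shift-surjective : ∀ j → t < m → ∃ λ u → u < m × shift m j u ≡ t
shift-surjective zero    t<m = _ , t<m , refl
shift-surjective (suc j) t<m with shift-surjective j t<m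
... | u , u<m , refl with cycSucc-surjective u<m
...   | w , w<m , refl = w , w<m , refl

shift-inner : ∀ j t → j + t < m → shift m j t ≡ j + t
shift-inner zero    t _ = refl
shift-inner {m} (suc j) t sj+t<m = begin
  shift m j (cycSucc m t) ≡⟨ cong (shift m j) (cycSucc-inner (≤-<-trans (s≤s (m≤n+m t j)) sj+t<m)) ⟩
  shift m j (suc t)       ≡⟨ shift-inner j (suc t) (subst (_< m) (sym (+-suc j t)) sj+t<m) ⟩
  j + suc t               ≡⟨ +-suc j t ⟩
  suc j + t               ∎
  where open ≡-Reasoning

shift-zero : j < m → shift m j 0 ≡ j
shift-zero {j} {m} j<m = trans (shift-inner j 0 (subst (_< m) (sym (+-identityʳ j)) j<m)) (+-identityʳ j)

shift-last : j < suc M → CycSuccℕ (suc M) t j → shift (suc M) j M ≡ t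
shift-last {M = M} {t} j<m (inj₁ refl) = begin
  shift (suc M) t (cycSucc (suc M) M) ≡⟨ cong (shift (suc M) t) (cycSucc-last refl) ⟩
  shift (suc M) t 0                   ≡⟨ shift-zero (<⇒≤ j<m) ⟩
  t                                   ∎
  where open ≡-Reasoning
shift-last _ (inj₂ (st≡m , refl)) = sym (suc-injective st≡m)

Gap : (ℕ → Set) → ℕ → ℕ → Set
Gap P a b = P a × P b × (∀ t → a < t → t < b → ¬ P t)

module _ {P : ℕ → Set} (P? : ∀ t → Dec (P t)) where

  last-satisfying : ∀ {lo} k → lo ≤ k → P lo →
    ∃ λ a → lo ≤ a × a ≤ k × P a × (∀ t → a < t → t ≤ k → ¬ P t)
  last-satisfying k lo≤k Plo with P? k
  ... | yes Pk = k , lo≤k , ≤-refl , Pk , λ t k<t t≤k → ⊥-elim (<⇒≱ k<t t≤k)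
  last-satisfying zero z≤n Plo | no ¬P0 = ⊥-elim (¬P0 Plo)
  last-satisfying (suc k) lo≤sk Plo | no ¬Psk with m≤n⇒m<n∨m≡n lo≤sk
  ... | inj₂ refl = ⊥-elim (¬Psk Plo)
  ... | inj₁ lo<sk with last-satisfying k (≤-pred lo<sk) Plo
  ...   | a , lo≤a , a≤k , Pa , after = a , lo≤a , m≤n⇒m≤1+n a≤k , Pa , λ t a<t t≤sk →
          [ (λ t<sk → after t a<t (≤-pred t<sk)) , (λ { refl → ¬Psk }) ]′ (m≤n⇒m<n∨m≡n t≤sk)

  first-satisfying : ∀ k e → P (k + e) →
    ∃ λ b → k ≤ b × b ≤ k + e × P b × (∀ t → k ≤ t → t < b → ¬ P t)
  first-satisfying k e Pk+e with P? k
  ... | yes Pk = k , ≤-refl , m≤m+n k e , Pk , λ t k≤t t<k → ⊥-elim (<⇒≱ t<k k≤t)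
  first-satisfying k zero Pk+0 | no ¬Pk = ⊥-elim (¬Pk (subst P (+-identityʳ k) Pk+0))
  first-satisfying k (suc e) Pk+se | no ¬Pk with first-satisfying (suc k) e (subst P (+-suc k e) Pk+se)
  ... | b , sk≤b , b≤sk+e , Pb , before = b , <⇒≤ sk≤b , subst (b ≤_) (sym (+-suc k e)) b≤sk+e , Pb ,
        λ t k≤t t<b → [ (λ k<t → before t k<t t<b) , (λ { refl → ¬Pk }) ]′ (m≤n⇒m<n∨m≡n k≤t)

  enclosing-gap : ∀ lo hi → lo < s → s < hi → P lo → P hi → ¬ P s →
    ∃ λ a → ∃ λ b → lo ≤ a × a < s × s < b × b ≤ hi × Gap P a b
  enclosing-gap {s} lo hi lo<s s<hi Plo Phi ¬Ps
    with last-satisfying s (<⇒≤ lo<s) Plo | m≤n⇒∃[o]m+o≡n (<⇒≤ s<hi)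
  ... | a , lo≤a , a≤s , Pa , after | e , refl with first-satisfying s e Phi
  ...   | b , s≤b , b≤hi , Pb , before =
    a , b , lo≤a , ≤∧≢⇒< a≤s (λ { refl → ¬Ps Pa }) , ≤∧≢⇒< s≤b (λ { refl → ¬Ps Pb }) , b≤hi ,
    Pa , Pb , λ t a<t t<b → [ (λ t≤s → after t a<t t≤s) , (λ s≤t → before t s≤t t<b) ]′ (≤-total t s)

-- The new hole is v, d a, d (a + 1), …, d (a + D); no-wrap excludes the case
-- that d a and d (a + D) are the adjacent positions 0 and m - 1 of H.
module GapHole {G : Graph n} {d : ℕ → Fin n} (H : IsHoleℕ G m d) (v : Fin n)
  (v∉d : ∀ t → t < m → v ≢ d t) {a D : ℕ} (2≤D : 2 ≤ D) (a+D<m : a + D < m)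
  (gap : Gap (λ t → Adj G v (d t)) a (a + D)) (no-wrap : 0 < a ⊎ suc (a + D) < m) where

  L : ℕ
  L = 2 + D

  e : ℕ → Fin n
  e zero    = v
  e (suc u) = d (a + u)

  arc-< : ∀ {u} → suc u < L → a + u < m
  arc-< su<L = ≤-<-trans (+-monoʳ-≤ a (≤-pred (≤-pred su<L))) a+D<m

  v-adj⇒cycAdj : ∀ {w} → suc w < L → Adj G v (d (a + w)) → CycAdjℕ L 0 (suc w)
  v-adj⇒cycAdj {w} sw<L v~dw with w ≟ 0 | w ≟ D
  ... | yes refl | _        = inj₁ (inj₁ refl)
  ... | no _     | yes refl = inj₂ (inj₂ (refl , refl))
  ... | no w≢0   | no w≢D   =
    ⊥-elim (proj₂ (proj₂ gap) (a + w) (m<m+n a (n≢0⇒n>0 w≢0))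
                              (+-monoʳ-< a (≤∧≢⇒< (≤-pred (≤-pred sw<L)) w≢D)) v~dw)

  cycAdj⇒v-adj : ∀ {w} → CycAdjℕ L 0 (suc w) → Adj G v (d (a + w))
  cycAdj⇒v-adj (inj₁ (inj₁ refl))      = subst (Adj G v ∘ d) (sym (+-identityʳ a)) (proj₁ gap)
  cycAdj⇒v-adj (inj₂ (inj₂ (refl , _))) = proj₁ (proj₂ gap)

  arc-CycSucc : ∀ {u w} → u ≤ D → CycSuccℕ m (a + u) (a + w) → w ≡ suc u
  arc-CycSucc {u} {w} _ (inj₁ r) = +-cancelˡ-≡ a w (suc u) (trans r (sym (+-suc a u)))
  arc-CycSucc {u} u≤D (inj₂ (sa+u≡m , a+w≡0)) =
    [ (λ 0<a → ⊥-elim (<⇒≢ 0<a (sym (m+n≡0⇒m≡0 a a+w≡0))))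
    , (λ sa+D<m → ⊥-elim (<-irrefl sa+u≡m (≤-<-trans (s≤s (+-monoʳ-≤ a u≤D)) sa+D<m)))
    ]′ no-wrap

  CycSucc-arc : ∀ {u w} → CycSuccℕ L (suc u) (suc w) → CycSuccℕ m (a + u) (a + w)
  CycSucc-arc {u} (inj₁ r) = inj₁ (trans (cong (a +_) (suc-injective r)) (+-suc a u))

  adj⇒cycAdj′ : ∀ x y → x < L → y < L → Adj G (e x) (e y) → CycAdjℕ L x y
  adj⇒cycAdj′ zero    zero    _ _ v~v = ⊥-elim (adj-irrefl G v~v)
  adj⇒cycAdj′ zero    (suc w) _ q a~  = v-adj⇒cycAdj q a~
  adj⇒cycAdj′ (suc u) zero    p _ a~  = cycAdj-sym (v-adj⇒cycAdj p (adj-sym G a~))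
  adj⇒cycAdj′ (suc u) (suc w) p q a~ with adj⇒cycAdj H (arc-< p) (arc-< q) a~
  ... | inj₁ r = inj₁ (inj₁ (cong suc (arc-CycSucc (≤-pred (≤-pred p)) r)))
  ... | inj₂ r = inj₂ (inj₁ (cong suc (arc-CycSucc (≤-pred (≤-pred q)) r)))

  cycAdj⇒adj′ : ∀ x y → x < L → y < L → CycAdjℕ L x y → Adj G (e x) (e y)
  cycAdj⇒adj′ zero    zero    _ _ (inj₁ (inj₁ ()))
  cycAdj⇒adj′ zero    zero    _ _ (inj₂ (inj₁ ()))
  cycAdj⇒adj′ zero    (suc w) _ _ r        = cycAdj⇒v-adj r
  cycAdj⇒adj′ (suc u) zero    _ _ r        = adj-sym G (cycAdj⇒v-adj (cycAdj-sym r))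
  cycAdj⇒adj′ (suc u) (suc w) p q (inj₁ r) = cycAdj⇒adj H (arc-< p) (arc-< q) (inj₁ (CycSucc-arc r))
  cycAdj⇒adj′ (suc u) (suc w) p q (inj₂ r) = cycAdj⇒adj H (arc-< p) (arc-< q) (inj₂ (CycSucc-arc r))

  e-injective : ∀ x y → x < L → y < L → e x ≡ e y → x ≡ y
  e-injective zero    zero    _ _ _  = refl
  e-injective zero    (suc w) _ q eq = ⊥-elim (v∉d _ (arc-< q) eq)
  e-injective (suc u) zero    p _ eq = ⊥-elim (v∉d _ (arc-< p) (sym eq))
  e-injective (suc u) (suc w) p q eq = cong suc (+-cancelˡ-≡ a u w (injective H (arc-< p) (arc-< q) eq))

  onHole : OnHole G v
  onHole = L , e ∘ toℕ , (s≤s (s≤s 2≤D) , e∘toℕ-injective , adjacency) , zero , refl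
    where
    e∘toℕ-injective : ∀ {x y} → e (toℕ x) ≡ e (toℕ y) → x ≡ y
    e∘toℕ-injective {x} {y} eq = toℕ-injective (e-injective _ _ (toℕ<n x) (toℕ<n y) eq)
    adjacency : ∀ x y → (Adj G (e (toℕ x)) (e (toℕ y)) → CycAdj L x y) ×
                        (CycAdj L x y → Adj G (e (toℕ x)) (e (toℕ y)))
    adjacency x y = adj⇒cycAdj′ _ _ (toℕ<n x) (toℕ<n y) , cycAdj⇒adj′ _ _ (toℕ<n x) (toℕ<n y)

onHole-of-gap : {G : Graph n} {d : ℕ → Fin n} → IsHoleℕ G m d → (v : Fin n) →
  (∀ t → t < m → v ≢ d t) → 2 + a ≤ b → b < m →
  Gap (λ t → Adj G v (d t)) a b → 0 < a ⊎ suc b < m → OnHole G v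
onHole-of-gap {a = a} H v v∉d 2+a≤b b<m gap no-wrap with m≤n⇒∃[o]m+o≡n (≤-trans (n≤1+n a) (<⇒≤ 2+a≤b))
... | D , refl = GapHole.onHole H v v∉d 2≤D b<m gap no-wrap
  where
  2≤D : 2 ≤ D
  2≤D = +-cancelˡ-≤ a 2 D (subst (_≤ a + D) (+-comm 2 a) 2+a≤b)

onHole-of-interior-neighbour : {G : Graph n} {d : ℕ → Fin n} {q : ℕ} →
  IsHoleℕ G (suc M) d → (v : Fin n) → (∀ t → t < suc M → v ≢ d t) →
  Adj G v (d 0) → Adj G v (d M) → 0 < q → q < M → Adj G v (d q) →
  s < suc M → ¬ Adj G v (d s) → OnHole G v
onHole-of-interior-neighbour {s = s} {G = G} {d} {q} H v v∉d v~d0 v~dM 0<q q<M v~dq s<m v≁ds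
  with <-cmp s q
... | tri≈ _ refl _ = ⊥-elim (v≁ds v~dq)
... | tri< s<q _ _
  with enclosing-gap (λ t → adj-dec G v (d t)) 0 q (n≢0⇒n>0 λ { refl → v≁ds v~d0 }) s<q v~d0 v~dq v≁ds
...   | a , b , _ , a<s , s<b , b≤q , gap =
  onHole-of-gap H v v∉d (≤-trans (s≤s a<s) s<b) (s≤s (≤-trans b≤q (<⇒≤ q<M))) gap
    (inj₂ (s≤s (≤-<-trans b≤q q<M)))
onHole-of-interior-neighbour {M = M} {s = s} {G = G} {d} {q} H v v∉d v~d0 v~dM 0<q q<M v~dq s<m v≁ds
  | tri> _ _ q<s
  with enclosing-gap (λ t → adj-dec G v (d t)) q M q<s (≤∧≢⇒< (≤-pred s<m) λ { refl → v≁ds v~dM }) v~dq v~dM v≁ds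
...   | a , b , q≤a , a<s , s<b , b≤M , gap =
  onHole-of-gap H v v∉d (≤-trans (s≤s a<s) s<b) (s≤s b≤M) gap (inj₁ (<-≤-trans 0<q q≤a))

-- Cutting C at the edge c i c i′ puts c i′ at position 0 and c i at position M.
onHole-of-three-neighbours : (G : Graph n) (c : Fin m → Fin n) → IsHole G m c →
  (v : Fin n) (i i′ l : Fin m) → CycSucc m i i′ → ¬ InX G c v → ¬ InC c v →
  Adj G v (c i) → Adj G v (c i′) → Adj G v (c l) → c l ≢ c i → c l ≢ c i′ → OnHole G v
onHole-of-three-neighbours {m = suc M} G c hole v i i′ l i→i′ v∉X v∉C v~ci v~ci′ v~cl cl≢ci cl≢ci′ =
  onHole-of-interior-neighbour H v (λ _ _ eq → v∉C (_ , sym eq)) (subst (Adj G v) (sym d0≡ci′) v~ci′)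
    (subst (Adj G v) (sym dM≡ci) v~ci) 0<q q<M (subst (Adj G v) (sym dq≡cl) v~cl)
    (proj₁ (proj₂ s-pos)) λ v~ds → proj₂ non-nbr (subst (Adj G v) (proj₂ (proj₂ s-pos)) v~ds)
  where
  d : ℕ → Fin _
  d t = c (shift (suc M) (toℕ i′) t mod suc M)

  H : IsHoleℕ G (suc M) d
  H = shift-hole (toℕ i′) (isHoleℕ hole)

  vertex-at : ∀ {t} x → t ≡ toℕ x → c (t mod suc M) ≡ c x
  vertex-at x refl = cong c (toℕ-injective (toℕ-mod (toℕ<n x)))

  position : (x : Fin (suc M)) → ∃ λ u → u < suc M × d u ≡ c x
  position x with shift-surjective (toℕ i′) (toℕ<n x)
  ... | u , u<m , eq = u , u<m , vertex-at x eq

  d0≡ci′ : d 0 ≡ c i′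
  d0≡ci′ = vertex-at i′ (shift-zero (toℕ<n i′))

  dM≡ci : d M ≡ c i
  dM≡ci = vertex-at i (shift-last (toℕ<n i′) i→i′)

  non-nbr : ∃ λ x → ¬ Adj G v (c x)
  non-nbr = ¬∀⟶∃¬ (suc M) (λ x → Adj G v (c x)) (λ x → adj-dec G v (c x)) v∉X
  s-pos : ∃ λ u → u < suc M × d u ≡ c (proj₁ non-nbr)
  s-pos = position (proj₁ non-nbr)

  q : ℕ
  q = proj₁ (position l)

  dq≡cl : d q ≡ c l
  dq≡cl = proj₂ (proj₂ (position l))

  0<q : 0 < q
  0<q = n≢0⇒n>0 λ q≡0 → cl≢ci′ (trans (sym dq≡cl) (trans (cong d q≡0) d0≡ci′))

  q<M : q < M
  q<M = ≤∧≢⇒< (≤-pred (proj₁ (proj₂ (position l))))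
               λ q≡M → cl≢ci (trans (sym dq≡cl) (trans (cong d q≡M) dM≡ci))

lemma8 : ∀ {n} (G : Graph n) (m : ℕ) (c : Fin m → Fin n) → IsHole G m c →
    (v : Fin n) (i i′ : Fin m) → CycSucc m i i′ →
    Adj G v (c i) → Adj G v (c i′) → ¬ InX G c v → ¬ OnHole G v →
    (k : ℕ) (p : Fin (suc k) → Fin n) → IsPath G k p → CAvoiding G c k p →
    p zero ≡ v → (l : Fin m) → p (fromℕ k) ≡ c l → c l ≢ c i → c l ≢ c i′ →
    2 ≤ k
lemma8 _ _ _ _ _ _ _ _ _ _ _ _ zero _ _ (inj₁ (() , _)) _ _ _ _ _
lemma8 _ _ _ _ _ _ _ _ _ _ _ _ zero _ _ (inj₂ (() , _)) _ _ _ _ _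
lemma8 _ _ _ _ _ _ _ _ _ _ _ _ 1 _ _ (inj₁ (s≤s () , _)) _ _ _ _ _
lemma8 G m c hole v i i′ i→i′ v~ci v~ci′ v∉X v∉hole 1 p path (inj₂ (_ , end-off)) p0≡v l p1≡cl cl≢ci cl≢ci′ =
  ⊥-elim (v∉hole (onHole-of-three-neighbours G c hole v i i′ l i→i′ v∉X v∉C v~ci v~ci′ v~cl cl≢ci cl≢ci′))
  where
  v∉C : ¬ InC c v
  v∉C v∈C = [ (λ p0∉ → p0∉ (inj₁ (subst (InC c) (sym p0≡v) v∈C)))
            , (λ p1∉ → p1∉ (inj₁ (l , sym p1≡cl))) ]′ end-off
  v~cl : Adj G v (c l)
  v~cl = subst₂ (Adj G) p0≡v p1≡cl (proj₂ path zero)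
lemma8 _ _ _ _ _ _ _ _ _ _ _ _ (suc (suc _)) _ _ _ _ _ _ _ _ = s≤s (s≤s z≤n)
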